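{- Let $\alpha\in\{0,4,8\}$ and let $u,s$ be positive integers with $u>12s+\alpha$. Then the graph $\langle \mathbb Z_u, L\rangle$ can be decomposed into $3$-suns, where: (i) if $\alpha=0$, $L=\{1,2,\dots,6s\}$; (ii) if $\alpha=4$, $L=\{3,4,\dots,6s+2\}$; (iii) if $\alpha=8$, $L=\{3,4,\dots,6s+4\}\setminus\{4,6s+3\}$.
   Context: A $3$-sun is the graph on six vertices $a,b,c,d,e,f$ with edges $\{a,b\},\{b,c\},\{c,a\},\{a,d\},\{b,e\},\{c,f\}$; a decomposition of a graph into $3$-suns is a partition of its edge set into subgraphs isomorphic to a $3$-sun. For a positive integer $u$, $\mathbb Z_u=\{0,1,\dots,u-1\}$ (integers mod $u$), and for distinct $i,j\in\mathbb Z_u$, $|i-j|_u=\min\{|i-j|,u-|i-j|\}$. For a nonempty set $L\subseteq\{1,\dots,\lfloor u/2\rfloor\}$, $\langle \mathbb Z_u,L\rangle$ is the graph with vertex set $\mathbb Z_u$ and edge set $\{\{i,j\}: i,j\in\mathbb Z_u,\ |i-j|_u\in L\}$. -}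

module Defs where

open import Data.Nat using (ℕ; _+_; _*_; _∸_; _≤_; _<_; _⊓_; ∣_-_∣)
open import Data.Product using (_×_; _,_; Σ; ∃-syntax)
open import Data.Sum using (_⊎_)
open import Data.Empty using (⊥)
open import Data.List using (List; _∷_; []; length; lookup)
open import Data.List.Relation.Unary.All using (All)
open import Data.List.Relation.Unary.Any using (Any)
open import Data.List.Relation.Unary.Unique.Propositional using (Unique)
open import Data.Fin using (Fin)
open import Relation.Binary.PropositionalEquality using (_≡_; _≢_)

dist : ℕ → ℕ → ℕ → ℕ
dist u i j = ∣ i - j ∣ ⊓ (u ∸ ∣ i - j ∣)

-- an unordered pair {x , y}, represented by an ordered pair
Edge : Set
Edge = ℕ × ℕ

SameEdge : Edge → Edge → Set
SameEdge (x , y) (i , j) = (x ≡ i × y ≡ j) ⊎ (x ≡ j × y ≡ i)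

IsEdge : ℕ → (ℕ → Set) → Edge → Set
IsEdge u L (i , j) = i < u × j < u × i ≢ j × L (dist u i j)

record Sun : Set where
  constructor sun
  field
    a b c d e f : ℕ

sunVertices : Sun → List ℕ
sunVertices (sun a b c d e f) = a ∷ b ∷ c ∷ d ∷ e ∷ f ∷ []

sunEdges : Sun → List Edge
sunEdges (sun a b c d e f) =
  (a , b) ∷ (b , c) ∷ (c , a) ∷ (a , d) ∷ (b , e) ∷ (c , f) ∷ []

EdgeOf : Edge → Sun → Set
EdgeOf x S = Any (SameEdge x) (sunEdges S)

SunIn : ℕ → (ℕ → Set) → Sun → Set
SunIn u L S = Unique (sunVertices S) × All (IsEdge u L) (sunEdges S)

Decomposition : ℕ → (ℕ → Set) → List Sun → Set
Decomposition u L D =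
  All (SunIn u L) D ×
  ((x : Edge) → IsEdge u L x →
     ∃[ k ] (EdgeOf x (lookup D k) ×
             ((k′ : Fin (length D)) → EdgeOf x (lookup D k′) → k′ ≡ k)))

HasSunDecomposition : ℕ → (ℕ → Set) → Set
HasSunDecomposition u L = ∃[ D ] Decomposition u L D

Lset : ℕ → ℕ → ℕ → Set
Lset 0 s l = 1 ≤ l × l ≤ 6 * s
Lset 4 s l = 3 ≤ l × l ≤ 6 * s + 2
Lset 8 s l = 3 ≤ l × l ≤ 6 * s + 4 × l ≢ 4 × l ≢ 6 * s + 3
Lset _ s l = ⊥

module Submission where

-- Translating a sun by t ∈ ℤ_u preserves its edge lengths, and an edge {i, j} of
-- ⟨ℤ_u, L⟩ is determined by its length d and by its endpoint l with l + d ≡ the other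
-- endpoint (mod u), which is unique when 0 < 2d < u. Hence if the edge lengths of base
-- suns B_0, …, B_{s-1} run through L exactly once, the s·u translates B_k + t form a
-- 3-sun decomposition.
--
-- Write x_j = 2(o+j)+1 and y_j = 2(e+j) with e + z = 2o + 1, z + z̄ = 1. The base sun
-- B_k has triangle 0, x_k, x_k + x_{s+k} and pendant edges of lengths y_k at 0,
-- y_{s+2k+z̄} at x_k and x_{2s+k} at x_k + x_{s+k}. Since x_k + x_{s+k} = y_{s+2k+z}, its
-- lengths are x_k, x_{s+k}, x_{2s+k}, y_k, y_{s+2k+z}, y_{s+2k+z̄}, so for k < s every x_j
-- and every y_j with j < 3s occurs exactly once. The parameters (o, e, z) = (0,1,0),
-- (1,2,1), (1,3,0) produce exactly L for α = 0, 4, 8, and u > 12s + α keeps all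
-- vertices below u and all lengths below u/2.

open import Defs
open import Data.Nat using (ℕ; zero; suc; s≤s⁻¹; _+_; _*_; _∸_; _<_; _≤_; _⊓_; ∣_-_∣; _≟_; _<?_; NonZero; >-nonZero; >-nonZero⁻¹; z≤n; s≤s; _%_; _/_)
open import Data.Nat.Properties
open import Data.Nat.DivMod
open import Data.Nat.Tactic.RingSolver using (solve-∀)
open import Data.Product using (_×_; _,_; ∃-syntax; proj₁; proj₂)
open import Data.Sum using (_⊎_; inj₁; inj₂; swap)
open import Data.Empty using (⊥-elim)
open import Data.List using (_∷_; []; map; length; lookup; applyUpTo)
open import Data.List.Properties using (length-applyUpTo; lookup-applyUpTo)
open import Data.List.Relation.Unary.All as All using (All; _∷_; [])
open import Data.List.Relation.Unary.All.Properties using (applyUpTo⁺₁; map⁺)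
open import Data.List.Relation.Unary.Any using (here; there)
open import Data.List.Relation.Unary.Unique.Propositional using (Unique)
open import Data.List.Relation.Unary.AllPairs using (_∷_; [])
open import Data.Fin using (Fin; toℕ; fromℕ<)
open import Data.Fin.Properties using (toℕ-fromℕ<; toℕ-injective; toℕ<n)
open import Function using (_∘_)
open import Relation.Nullary using (yes; no)
open import Relation.Binary.PropositionalEquality

data Slot : Set where
  ab bc ca ad be cf : Slot

sunEdge : Sun → Slot → Edge
sunEdge (sun a b c d e f) ab = a , b
sunEdge (sun a b c d e f) bc = b , c
sunEdge (sun a b c d e f) ca = c , a
sunEdge (sun a b c d e f) ad = a , d
sunEdge (sun a b c d e f) be = b , e
sunEdge (sun a b c d e f) cf = c , f

EdgeOf⇒slot : ∀ {x} S → EdgeOf x S → ∃[ p ] SameEdge x (sunEdge S p)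
EdgeOf⇒slot S (here q) = ab , q
EdgeOf⇒slot S (there (here q)) = bc , q
EdgeOf⇒slot S (there (there (here q))) = ca , q
EdgeOf⇒slot S (there (there (there (here q)))) = ad , q
EdgeOf⇒slot S (there (there (there (there (here q))))) = be , q
EdgeOf⇒slot S (there (there (there (there (there (here q)))))) = cf , q

slot⇒EdgeOf : ∀ {x} S p → SameEdge x (sunEdge S p) → EdgeOf x S
slot⇒EdgeOf S ab q = here q
slot⇒EdgeOf S bc q = there (here q)
slot⇒EdgeOf S ca q = there (there (here q))
slot⇒EdgeOf S ad q = there (there (there (here q)))
slot⇒EdgeOf S be q = there (there (there (there (here q))))
slot⇒EdgeOf S cf q = there (there (there (there (there (here q)))))

All-sunEdges : ∀ {P : Edge → Set} S → (∀ p → P (sunEdge S p)) → All P (sunEdges S)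
All-sunEdges S P-slot =
  P-slot ab ∷ P-slot bc ∷ P-slot ca ∷ P-slot ad ∷ P-slot be ∷ P-slot cf ∷ []

sunEdge-endpoints : ∀ {P : ℕ → Set} S p → All P (sunVertices S) →
                    P (proj₁ (sunEdge S p)) × P (proj₂ (sunEdge S p))
sunEdge-endpoints S ab (a ∷ b ∷ c ∷ d ∷ e ∷ f ∷ []) = a , b
sunEdge-endpoints S bc (a ∷ b ∷ c ∷ d ∷ e ∷ f ∷ []) = b , c
sunEdge-endpoints S ca (a ∷ b ∷ c ∷ d ∷ e ∷ f ∷ []) = c , a
sunEdge-endpoints S ad (a ∷ b ∷ c ∷ d ∷ e ∷ f ∷ []) = a , d
sunEdge-endpoints S be (a ∷ b ∷ c ∷ d ∷ e ∷ f ∷ []) = b , e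
sunEdge-endpoints S cf (a ∷ b ∷ c ∷ d ∷ e ∷ f ∷ []) = c , f

sunEdge-distinct : ∀ S p → Unique (sunVertices S) → proj₁ (sunEdge S p) ≢ proj₂ (sunEdge S p)
sunEdge-distinct S ab ((a≢b ∷ _) ∷ _) = a≢b
sunEdge-distinct S bc (_ ∷ (b≢c ∷ _) ∷ _) = b≢c
sunEdge-distinct S ca ((_ ∷ a≢c ∷ _) ∷ _) = a≢c ∘ sym
sunEdge-distinct S ad ((_ ∷ _ ∷ a≢d ∷ _) ∷ _) = a≢d
sunEdge-distinct S be (_ ∷ (_ ∷ _ ∷ b≢e ∷ _) ∷ _) = b≢e
sunEdge-distinct S cf (_ ∷ _ ∷ (_ ∷ _ ∷ c≢f ∷ _) ∷ _) = c≢f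

SameEdge-sym : ∀ {x y} → SameEdge x y → SameEdge y x
SameEdge-sym {_ , _} {_ , _} (inj₁ (p , q)) = inj₁ (sym p , sym q)
SameEdge-sym {_ , _} {_ , _} (inj₂ (p , q)) = inj₂ (sym q , sym p)

SameEdge-trans : ∀ {x y z} → SameEdge x y → SameEdge y z → SameEdge x z
SameEdge-trans {_ , _} {_ , _} {_ , _} (inj₁ (p , q)) (inj₁ (p′ , q′)) = inj₁ (trans p p′ , trans q q′)
SameEdge-trans {_ , _} {_ , _} {_ , _} (inj₁ (p , q)) (inj₂ (p′ , q′)) = inj₂ (trans p p′ , trans q q′)
SameEdge-trans {_ , _} {_ , _} {_ , _} (inj₂ (p , q)) (inj₁ (p′ , q′)) = inj₂ (trans p q′ , trans q p′)
SameEdge-trans {_ , _} {_ , _} {_ , _} (inj₂ (p , q)) (inj₂ (p′ , q′)) = inj₁ (trans p q′ , trans q p′)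

Unique-map-injectiveOn : ∀ {P : ℕ → Set} (f : ℕ → ℕ) →
  (∀ {x y} → P x → P y → f x ≡ f y → x ≡ y) →
  ∀ {xs} → All P xs → Unique xs → Unique (map f xs)
Unique-map-injectiveOn f inj [] [] = []
Unique-map-injectiveOn f inj (px ∷ pxs) (x∉xs ∷ xs!) =
  map⁺ (All.zipWith (λ (x≢y , py) fx≡fy → x≢y (inj px py fx≡fy)) (x∉xs , pxs))
  ∷ Unique-map-injectiveOn f inj pxs xs!

[q*n+r]%n≡r : ∀ q r n .{{_ : NonZero n}} → r < n → (q * n + r) % n ≡ r
[q*n+r]%n≡r q r n r<n =
  trans (cong (_% n) (+-comm (q * n) r)) (trans ([m+kn]%n≡m%n r q n) (m<n⇒m%n≡m r<n))

[q*n+r]/n≡q : ∀ q r n .{{_ : NonZero n}} → r < n → (q * n + r) / n ≡ q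
[q*n+r]/n≡q q r n r<n = *-cancelʳ-≡ _ q n (+-cancelˡ-≡ r _ _ (begin
  r + (q * n + r) / n * n                 ≡⟨ cong (_+ (q * n + r) / n * n) ([q*n+r]%n≡r q r n r<n) ⟨
  (q * n + r) % n + (q * n + r) / n * n   ≡⟨ m≡m%n+[m/n]*n (q * n + r) n ⟨
  q * n + r                               ≡⟨ +-comm (q * n) r ⟩
  r + q * n                               ∎))
  where open ≡-Reasoning

module Circle (u : ℕ) .{{_ : NonZero u}} where

  infixl 6 _⊕_ _⊖_

  _⊕_ : ℕ → ℕ → ℕ
  x ⊕ t = (x + t) % u

  _⊖_ : ℕ → ℕ → ℕ
  x ⊖ t = x ⊕ (u ∸ t)

  ⊕-< : ∀ x t → x ⊕ t < u
  ⊕-< x t = m%n<n (x + t) u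

  ⊕-comm : ∀ x t → x ⊕ t ≡ t ⊕ x
  ⊕-comm x t = cong (_% u) (+-comm x t)

  ⊕-assoc : ∀ x s t → x ⊕ s ⊕ t ≡ x ⊕ (s + t)
  ⊕-assoc x s t = begin
    ((x + s) % u + t) % u            ≡⟨ %-distribˡ-+ ((x + s) % u) t u ⟩
    ((x + s) % u % u + t % u) % u    ≡⟨ cong (λ y → (y + t % u) % u) (m%n%n≡m%n (x + s) u) ⟩
    ((x + s) % u + t % u) % u        ≡⟨ %-distribˡ-+ (x + s) t u ⟨
    (x + s + t) % u                  ≡⟨ cong (_% u) (+-assoc x s t) ⟩
    (x + (s + t)) % u                ∎
    where open ≡-Reasoning

  ⊕-swap : ∀ x s t → x ⊕ s ⊕ t ≡ x ⊕ t ⊕ s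
  ⊕-swap x s t = trans (⊕-assoc x s t) (trans (cong (x ⊕_) (+-comm s t)) (sym (⊕-assoc x t s)))

  ⊕-identityʳ : ∀ {x} → x < u → x ⊕ 0 ≡ x
  ⊕-identityʳ {x} x<u = trans (cong (_% u) (+-identityʳ x)) (m<n⇒m%n≡m x<u)

  ⊕-u : ∀ {x} → x < u → x ⊕ u ≡ x
  ⊕-u {x} x<u = trans ([m+n]%n≡m%n x u) (m<n⇒m%n≡m x<u)

  ⊕-⊖ : ∀ {x t} → x < u → t ≤ u → x ⊕ t ⊖ t ≡ x
  ⊕-⊖ {x} {t} x<u t≤u =
    trans (⊕-assoc x t (u ∸ t)) (trans (cong (x ⊕_) (m+[n∸m]≡n t≤u)) (⊕-u x<u))

  ⊖-⊕ : ∀ {x t} → x < u → t ≤ u → x ⊖ t ⊕ t ≡ x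
  ⊖-⊕ {x} {t} x<u t≤u =
    trans (⊕-assoc x (u ∸ t) t) (trans (cong (x ⊕_) (m∸n+n≡m t≤u)) (⊕-u x<u))

  ⊕-cancelʳ : ∀ {x y t} → x < u → y < u → t ≤ u → x ⊕ t ≡ y ⊕ t → x ≡ y
  ⊕-cancelʳ {x} {y} {t} x<u y<u t≤u eq =
    trans (sym (⊕-⊖ x<u t≤u)) (trans (cong (_⊖ t) eq) (⊕-⊖ y<u t≤u))

  dist-comm : ∀ i j → dist u i j ≡ dist u j i
  dist-comm i j = cong (λ m → m ⊓ (u ∸ m)) (∣-∣-comm i j)

  dist-+ : ∀ x d → dist u x (x + d) ≡ d ⊓ (u ∸ d)
  dist-+ x d = cong (λ m → m ⊓ (u ∸ m)) (∣m-m+n∣≡n x d)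

  dist-+-half : ∀ x {d} → d + d ≤ u → dist u x (x + d) ≡ d
  dist-+-half x {d} d+d≤u = trans (dist-+ x d) (m≤n⇒m⊓n≡m (m+n≤o⇒m≤o∸n d d+d≤u))

  dist-⊕ : ∀ {x d} → x < u → d + d ≤ u → dist u x (x ⊕ d) ≡ d
  dist-⊕ {x} {d} x<u d+d≤u with x + d <? u
  ... | yes x+d<u = trans (cong (dist u x) (m<n⇒m%n≡m x+d<u)) (dist-+-half x d+d≤u)
  ... | no x+d≮u = begin
    dist u x ((x + d) % u)           ≡⟨ cong (dist u x) x⊕d≡w ⟩
    dist u x w                       ≡⟨ cong (λ y → dist u y w) x≡w+[u∸d] ⟩
    dist u (w + (u ∸ d)) w           ≡⟨ dist-comm (w + (u ∸ d)) w ⟩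
    dist u w (w + (u ∸ d))           ≡⟨ dist-+ w (u ∸ d) ⟩
    (u ∸ d) ⊓ (u ∸ (u ∸ d))          ≡⟨ cong ((u ∸ d) ⊓_) (m∸[m∸n]≡n d≤u) ⟩
    (u ∸ d) ⊓ d                      ≡⟨ m≥n⇒m⊓n≡n (m+n≤o⇒m≤o∸n d d+d≤u) ⟩
    d                                ∎
    where
    open ≡-Reasoning
    u≤x+d = ≮⇒≥ x+d≮u
    d≤u = ≤-trans (m≤m+n d d) d+d≤u
    w = x + d ∸ u
    x⊕d≡w : (x + d) % u ≡ w
    x⊕d≡w = trans (sym (m≤n⇒[n∸m]%m≡n%m u≤x+d))
      (m<n⇒m%n≡m (+-cancelˡ-< u w u
        (subst (_< u + u) (sym (m+[n∸m]≡n u≤x+d)) (+-mono-<-≤ x<u d≤u))))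
    x≡w+[u∸d] : x ≡ w + (u ∸ d)
    x≡w+[u∸d] = +-cancelʳ-≡ d x _ (begin
      x + d                  ≡⟨ m∸n+n≡m u≤x+d ⟨
      w + u                  ≡⟨ cong (w +_) (m∸n+n≡m d≤u) ⟨
      w + (u ∸ d + d)        ≡⟨ +-assoc w (u ∸ d) d ⟨
      w + (u ∸ d) + d        ∎)

  dist-reaches-≤ : ∀ {i j} → j < u → i ≤ j → i ⊕ dist u i j ≡ j ⊎ j ⊕ dist u i j ≡ i
  dist-reaches-≤ {i} j<u i≤j with m≤n⇒∃[o]m+o≡n i≤j
  ... | m , refl rewrite ∣m-m+n∣≡n i m with ≤-total m (u ∸ m)
  ... | inj₁ m≤u∸m rewrite m≤n⇒m⊓n≡m m≤u∸m = inj₁ (m<n⇒m%n≡m j<u)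
  ... | inj₂ u∸m≤m rewrite m≥n⇒m⊓n≡n u∸m≤m = inj₂ (begin
    (i + m + (u ∸ m)) % u   ≡⟨ cong (_% u) (+-assoc i m (u ∸ m)) ⟩
    (i + (m + (u ∸ m))) % u ≡⟨ cong (λ y → (i + y) % u) (m+[n∸m]≡n m≤u) ⟩
    i ⊕ u                   ≡⟨ ⊕-u (≤-<-trans (m≤m+n i m) j<u) ⟩
    i                       ∎)
    where
    open ≡-Reasoning
    m≤u = ≤-trans (m≤n+m m i) (<⇒≤ j<u)

  dist-reaches : ∀ {i j} → i < u → j < u → i ⊕ dist u i j ≡ j ⊎ j ⊕ dist u i j ≡ i
  dist-reaches {i} {j} i<u j<u with ≤-total i j
  ... | inj₁ i≤j = dist-reaches-≤ j<u i≤j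
  ... | inj₂ j≤i rewrite dist-comm i j = swap (dist-reaches-≤ i<u j≤i)

  start : ℕ → Edge → ℕ
  start d (i , j) with i ⊕ d ≟ j
  ... | yes _ = i
  ... | no _ = j

  start-< : ∀ {i j} d → i < u → j < u → start d (i , j) < u
  start-< {i} {j} d i<u j<u with i ⊕ d ≟ j
  ... | yes _ = i<u
  ... | no _ = j<u

  start-spec : ∀ {i j d} → i ⊕ d ≡ j ⊎ j ⊕ d ≡ i →
               SameEdge (i , j) (start d (i , j) , start d (i , j) ⊕ d)
  start-spec {i} {j} {d} reach with i ⊕ d ≟ j | reach
  ... | yes i⊕d≡j | _ = inj₁ (refl , sym i⊕d≡j)
  ... | no i⊕d≢j | inj₁ i⊕d≡j = ⊥-elim (i⊕d≢j i⊕d≡j)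
  ... | no _ | inj₂ j⊕d≡i = inj₂ (sym j⊕d≡i , refl)

  start-unique : ∀ {x A d} → A < u → 0 < d → d + d < u → SameEdge x (A , A ⊕ d) → start d x ≡ A
  start-unique {_ , _} {A} {d} _ _ _ (inj₁ (refl , refl)) with A ⊕ d ≟ A ⊕ d
  ... | yes _ = refl
  ... | no A⊕d≢A⊕d = ⊥-elim (A⊕d≢A⊕d refl)
  start-unique {_ , _} {A} {d} A<u 0<d d+d<u (inj₂ (refl , refl)) with A ⊕ d ⊕ d ≟ A
  ... | no _ = refl
  ... | yes A⊕d⊕d≡A = ⊥-elim (<⇒≢ 0<d (sym (m+n≡0⇒m≡0 d d+d≡0)))
    where
    -- A ⊕ d ⊕ d ≡ A forces d + d ≡ 0 (mod u), impossible for 0 < d + d < u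
    d+d≡0 : d + d ≡ 0
    d+d≡0 = ⊕-cancelʳ d+d<u (≤-<-trans z≤n A<u) (<⇒≤ A<u) (begin
      d + d ⊕ A      ≡⟨ ⊕-comm (d + d) A ⟩
      A ⊕ (d + d)    ≡⟨ ⊕-assoc A d d ⟨
      A ⊕ d ⊕ d      ≡⟨ A⊕d⊕d≡A ⟩
      A              ≡⟨ m<n⇒m%n≡m A<u ⟨
      0 ⊕ A          ∎)
      where open ≡-Reasoning

  edgeLength : Edge → ℕ
  edgeLength (i , j) = dist u i j

  edgeLength-SameEdge : ∀ {x y} → SameEdge x y → edgeLength x ≡ edgeLength y
  edgeLength-SameEdge {_ , _} {_ , _} (inj₁ (refl , refl)) = refl
  edgeLength-SameEdge {_ , _} {i , j} (inj₂ (refl , refl)) = dist-comm j i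

SameEdge-loop : ∀ {i j A} → SameEdge (i , j) (A , A) → i ≡ j
SameEdge-loop (inj₁ (refl , refl)) = refl
SameEdge-loop (inj₂ (refl , refl)) = refl

[q*n+r]<m*n : ∀ {q r m n} → q < m → r < n → q * n + r < m * n
[q*n+r]<m*n {q} {r} {m} {n} q<m r<n = begin-strict
  q * n + r   <⟨ +-monoʳ-< (q * n) r<n ⟩
  q * n + n   ≡⟨ +-comm (q * n) n ⟩
  suc q * n   ≤⟨ *-monoˡ-≤ n q<m ⟩
  m * n       ∎
  where open ≤-Reasoning

applyUpTo-Decomposition : ∀ {u L} (g : ℕ → Sun) (N : ℕ) (index : Edge → ℕ) →
  (∀ {n} → n < N → SunIn u L (g n)) →
  (∀ {x} → IsEdge u L x → index x < N × EdgeOf x (g (index x))) →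
  (∀ {n x} → n < N → IsEdge u L x → EdgeOf x (g n) → index x ≡ n) →
  Decomposition u L (applyUpTo g N)
applyUpTo-Decomposition {u} {L} g N index g-SunIn index-complete index-unique =
  applyUpTo⁺₁ g N g-SunIn , covered-once
  where
  D = applyUpTo g N
  covered-once : (x : Edge) → IsEdge u L x →
    ∃[ k ] (EdgeOf x (lookup D k) × ((k′ : Fin (length D)) → EdgeOf x (lookup D k′) → k′ ≡ k))
  covered-once x x∈G = k , subst (EdgeOf x) (sym lookup-k) x∈g[index] , unique
    where
    index<N = proj₁ (index-complete x∈G)
    x∈g[index] = proj₂ (index-complete x∈G)
    index<length = subst (index x <_) (sym (length-applyUpTo g N)) index<N
    k = fromℕ< index<length
    lookup-k : lookup D k ≡ g (index x)
    lookup-k = trans (lookup-applyUpTo g N k) (cong g (toℕ-fromℕ< index<length))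
    unique : (k′ : Fin (length D)) → EdgeOf x (lookup D k′) → k′ ≡ k
    unique k′ x∈k′ =
      toℕ-injective (trans (sym (index-unique k′<N x∈G x∈g[k′])) (sym (toℕ-fromℕ< index<length)))
      where
      k′<N = subst (toℕ k′ <_) (length-applyUpTo g N) (toℕ<n k′)
      x∈g[k′] = subst (EdgeOf x) (lookup-applyUpTo g N k′) x∈k′

record BaseSuns (u : ℕ) .{{_ : NonZero u}} (L : ℕ → Set) : Set where
  open Circle u using (edgeLength)
  field
    size : ℕ
    block : ℕ → Sun
    slotOf : ℕ → ℕ × Slot
    vertices-distinct : ∀ {k} → k < size → Unique (sunVertices (block k))
    vertices-< : ∀ {k} → k < size → All (_< u) (sunVertices (block k))
    length∈L : ∀ {k} p → k < size → L (edgeLength (sunEdge (block k) p))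
    slotOf-length : ∀ {k} p → k < size → slotOf (edgeLength (sunEdge (block k) p)) ≡ (k , p)
    slotOf-complete : ∀ {d} → L d →
      proj₁ (slotOf d) < size × edgeLength (sunEdge (block (proj₁ (slotOf d))) (proj₂ (slotOf d))) ≡ d

-- If u/2 were a length, the translates by t and t + u/2 would share an edge.
module Development {u : ℕ} .{{_ : NonZero u}} {L : ℕ → Set}
                   (short : ∀ {d} → L d → d + d < u) (B : BaseSuns u L) where
  open BaseSuns B
  open Circle u

  translate : ℕ → Sun → Sun
  translate t (sun a b c d e f) = sun (a ⊕ t) (b ⊕ t) (c ⊕ t) (d ⊕ t) (e ⊕ t) (f ⊕ t)

  translateEdge : ℕ → Edge → Edge
  translateEdge t (i , j) = i ⊕ t , j ⊕ t

  sunEdge-translate : ∀ t S p → sunEdge (translate t S) p ≡ translateEdge t (sunEdge S p)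
  sunEdge-translate t S ab = refl
  sunEdge-translate t S bc = refl
  sunEdge-translate t S ca = refl
  sunEdge-translate t S ad = refl
  sunEdge-translate t S be = refl
  sunEdge-translate t S cf = refl

  SameEdge-translate : ∀ t {x y} → SameEdge x y → SameEdge (translateEdge t x) (translateEdge t y)
  SameEdge-translate t {_ , _} {_ , _} (inj₁ (refl , refl)) = inj₁ (refl , refl)
  SameEdge-translate t {_ , _} {_ , _} (inj₂ (refl , refl)) = inj₂ (refl , refl)

  slotLength : ℕ → Slot → ℕ
  slotLength k p = edgeLength (sunEdge (block k) p)

  slot-endpoints-< : ∀ {k} p → k < size →
                     proj₁ (sunEdge (block k) p) < u × proj₂ (sunEdge (block k) p) < u
  slot-endpoints-< {k} p k<size = sunEdge-endpoints (block k) p (vertices-< k<size)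

  slotStart : ℕ → Slot → ℕ
  slotStart k p = start (slotLength k p) (sunEdge (block k) p)

  slotStart-< : ∀ {k} p → k < size → slotStart k p < u
  slotStart-< {k} p k<size =
    start-< (slotLength k p) (proj₁ (slot-endpoints-< p k<size)) (proj₂ (slot-endpoints-< p k<size))

  translated-slot : ∀ t {k} p → k < size →
    SameEdge (sunEdge (translate t (block k)) p) (slotStart k p ⊕ t , slotStart k p ⊕ t ⊕ slotLength k p)
  translated-slot t {k} p k<size rewrite sunEdge-translate t (block k) p =
    SameEdge-trans (SameEdge-translate t (start-spec (dist-reaches x<u y<u)))
                   (inj₁ (refl , ⊕-swap (slotStart k p) (slotLength k p) t))
    where
    x<u = proj₁ (slot-endpoints-< p k<size)
    y<u = proj₂ (slot-endpoints-< p k<size)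

  translated-slotLength : ∀ t {k} p → k < size →
                          edgeLength (sunEdge (translate t (block k)) p) ≡ slotLength k p
  translated-slotLength t {k} p k<size =
    trans (edgeLength-SameEdge (translated-slot t p k<size))
          (dist-⊕ (⊕-< (slotStart k p) t) (<⇒≤ (short (length∈L p k<size))))

  sunAt : ℕ → Sun
  sunAt n = translate (n % u) (block (n / u))

  sunAt-block : ∀ {k t} → t < u → sunAt (k * u + t) ≡ translate t (block k)
  sunAt-block {k} {t} t<u =
    cong₂ (λ t k → translate t (block k)) ([q*n+r]%n≡r k t u t<u) ([q*n+r]/n≡q k t u t<u)

  translate-SunIn : ∀ {t k} → t ≤ u → k < size → SunIn u L (translate t (block k))
  translate-SunIn {t} {k} t≤u k<size = vertices! , All-sunEdges (translate t (block k)) slot∈G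
    where
    vertices! : Unique (sunVertices (translate t (block k)))
    vertices! = Unique-map-injectiveOn (_⊕ t) (λ x<u y<u → ⊕-cancelʳ x<u y<u t≤u)
                  (vertices-< k<size) (vertices-distinct k<size)
    slot∈G : ∀ p → IsEdge u L (sunEdge (translate t (block k)) p)
    slot∈G p with sunEdge (translate t (block k)) p | sunEdge-translate t (block k) p
                | sunEdge-distinct (translate t (block k)) p vertices! | translated-slotLength t p k<size
    ... | _ | refl | i≢j | length≡ = ⊕-< _ t , ⊕-< _ t , i≢j , subst L (sym length≡) (length∈L p k<size)

  indexAt : ℕ × Slot → ℕ → Edge → ℕ
  indexAt (k , p) d x = k * u + (start d x ⊖ slotStart k p)

  index : Edge → ℕ
  index x = indexAt (slotOf (edgeLength x)) (edgeLength x) x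

  index-complete : ∀ {x} → IsEdge u L x → index x < size * u × EdgeOf x (sunAt (index x))
  index-complete {i , j} (i<u , j<u , _ , Ld)
    with slotOf (dist u i j) | slotOf-complete Ld
  ... | k , p | k<size , slotLength≡d = [q*n+r]<m*n k<size (⊕-< l _) , x∈sunAt
    where
    d = dist u i j
    l = start d (i , j)
    st = slotStart k p
    t = l ⊖ st
    st⊕t≡l : st ⊕ t ≡ l
    st⊕t≡l = trans (⊕-comm st t) (⊖-⊕ (start-< d i<u j<u) (<⇒≤ (slotStart-< p k<size)))
    slot≅l : SameEdge (sunEdge (translate t (block k)) p) (l , l ⊕ d)
    slot≅l = subst₂ (λ A δ → SameEdge (sunEdge (translate t (block k)) p) (A , A ⊕ δ))
                    st⊕t≡l slotLength≡d (translated-slot t p k<size)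
    x∈sunAt : EdgeOf (i , j) (sunAt (k * u + t))
    x∈sunAt = subst (EdgeOf (i , j)) (sym (sunAt-block (⊕-< l (u ∸ st))))
      (slot⇒EdgeOf (translate t (block k)) p
        (SameEdge-trans (start-spec (dist-reaches i<u j<u)) (SameEdge-sym slot≅l)))

  index-unique : ∀ {n x} → n < size * u → IsEdge u L x → EdgeOf x (sunAt n) → index x ≡ n
  index-unique {n} {i , j} n<N (_ , _ , i≢j , _) x∈sunAt
    with EdgeOf⇒slot (translate (n % u) (block (n / u))) x∈sunAt
  ... | p , x≅slot = begin
    index (i , j)                            ≡⟨ cong (λ d → indexAt (slotOf d) d (i , j)) length≡δ ⟩
    indexAt (slotOf δ) δ (i , j)             ≡⟨ cong (λ kp → indexAt kp δ (i , j)) (slotOf-length p k<size) ⟩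
    k * u + (start δ (i , j) ⊖ st)           ≡⟨ cong (λ A → k * u + (A ⊖ st)) (start-unique (⊕-< st t) 0<δ δ+δ<u x≅A) ⟩
    k * u + (st ⊕ t ⊖ st)                    ≡⟨ cong (λ A → k * u + (A ⊖ st)) (⊕-comm st t) ⟩
    k * u + (t ⊕ st ⊖ st)                    ≡⟨ cong (k * u +_) (⊕-⊖ (m%n<n n u) (<⇒≤ (slotStart-< p k<size))) ⟩
    k * u + t                                ≡⟨ +-comm (k * u) t ⟩
    t + k * u                                ≡⟨ m≡m%n+[m/n]*n n u ⟨
    n                                        ∎
    where
    open ≡-Reasoning
    k = n / u
    t = n % u
    k<size = m<n*o⇒m/o<n n<N
    st = slotStart k p
    δ = slotLength k p
    δ+δ<u = short (length∈L p k<size)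
    x≅A : SameEdge (i , j) (st ⊕ t , st ⊕ t ⊕ δ)
    x≅A = SameEdge-trans x≅slot (translated-slot t p k<size)
    length≡δ : dist u i j ≡ δ
    length≡δ = trans (edgeLength-SameEdge x≅A) (dist-⊕ (⊕-< st t) (<⇒≤ δ+δ<u))
    0<δ : 0 < δ
    0<δ = n≢0⇒n>0 λ δ≡0 → i≢j (SameEdge-loop (subst (λ d → SameEdge (i , j) (st ⊕ t , d))
                                 (trans (cong (st ⊕ t ⊕_) δ≡0) (⊕-identityʳ (⊕-< st t))) x≅A))

  sunDecomposition : HasSunDecomposition u L
  sunDecomposition = applyUpTo sunAt (size * u) ,
    applyUpTo-Decomposition {u} {L} sunAt (size * u) index
      (λ {n} n<N → translate-SunIn (<⇒≤ (m%n<n n u)) (m<n*o⇒m/o<n n<N)) index-complete index-unique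

[m*2+r]<n*2 : ∀ {m n r} → r < 2 → m < n → m * 2 + r < n * 2
[m*2+r]<n*2 {m} {n} {r} r<2 m<n = begin-strict
  m * 2 + r   <⟨ +-monoʳ-< (m * 2) r<2 ⟩
  m * 2 + 2   ≡⟨ +-comm (m * 2) 2 ⟩
  suc m * 2   ≤⟨ *-monoˡ-≤ 2 m<n ⟩
  n * 2       ∎
  where open ≤-Reasoning

pair-< : ∀ {k s r} → r < 2 → k < s → k * 2 + r < 2 * s
pair-< {k} {s} {r} r<2 k<s = subst (k * 2 + r <_) (*-comm s 2) ([m*2+r]<n*2 r<2 k<s)

distinct-bits⇒sum≡1 : ∀ {a b} → a < 2 → b < 2 → a ≢ b → a + b ≡ 1
distinct-bits⇒sum≡1 {0} {0} _ _ 0≢0 = ⊥-elim (0≢0 refl)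
distinct-bits⇒sum≡1 {0} {1} _ _ _ = refl
distinct-bits⇒sum≡1 {1} {0} _ _ _ = refl
distinct-bits⇒sum≡1 {1} {1} _ _ 1≢1 = ⊥-elim (1≢1 refl)
distinct-bits⇒sum≡1 {suc (suc _)} (s≤s (s≤s ()))
distinct-bits⇒sum≡1 {_} {suc (suc _)} _ (s≤s (s≤s ()))

m+m≢1 : ∀ m → m + m ≢ 1
m+m≢1 (suc m) 1+m+1+m≡1 with trans (sym (+-suc m m)) (suc-injective 1+m+1+m≡1)
... | ()

sunVertices-distinct : ∀ {a b c d e f} → a < b → b < d → d < c → c < e → e < f →
                       Unique (sunVertices (sun a b c d e f))
sunVertices-distinct a<b b<d d<c c<e e<f =
    (≢ a<b ∷ ≢ a<c ∷ ≢ a<d ∷ ≢ a<e ∷ ≢ a<f ∷ [])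
  ∷ (≢ b<c ∷ ≢ b<d ∷ ≢ b<e ∷ ≢ b<f ∷ [])
  ∷ (≢ d<c ∘ sym ∷ ≢ c<e ∷ ≢ c<f ∷ [])
  ∷ (≢ d<e ∷ ≢ d<f ∷ [])
  ∷ (≢ e<f ∷ [])
  ∷ [] ∷ []
  where
  ≢ = <⇒≢
  d<e = <-trans d<c c<e
  b<c = <-trans b<d d<c
  a<d = <-trans a<b b<d
  c<f = <-trans c<e e<f
  d<f = <-trans d<e e<f
  b<e = <-trans b<c c<e
  b<f = <-trans b<e e<f
  a<c = <-trans a<b b<c
  a<e = <-trans a<c c<e
  a<f = <-trans a<e e<f

sunVertices-< : ∀ {u a b c d e f} → a < b → b < d → d < c → c < e → e < f → f < u →
                All (_< u) (sunVertices (sun a b c d e f))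
sunVertices-< a<b b<d d<c c<e e<f f<u = a<u ∷ b<u ∷ c<u ∷ d<u ∷ e<u ∷ f<u ∷ []
  where
  e<u = <-trans e<f f<u
  c<u = <-trans c<e e<u
  d<u = <-trans d<c c<u
  b<u = <-trans b<d d<u
  a<u = <-trans a<b b<u

-- z selects which of the two lengths y_{s+2k}, y_{s+2k+1} closes the triangle of B_k.
module SunFamily (s : ℕ) .{{_ : NonZero s}} (o e z z̄ : ℕ)
                 (z+z̄≡1 : z + z̄ ≡ 1) (e+z≡2o+1 : e + z ≡ o * 2 + 1) (o<e : o < e) where

  odd even : ℕ → ℕ
  odd j = (o + j) * 2 + 1
  even j = (e + j) * 2

  lengthAt : ℕ → Slot → ℕ
  lengthAt k ab = odd k
  lengthAt k bc = odd (s + k)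
  lengthAt k ca = even (s + (k * 2 + z))
  lengthAt k ad = even k
  lengthAt k be = even (s + (k * 2 + z̄))
  lengthAt k cf = odd (2 * s + k)

  block : ℕ → Sun
  block k = sun 0 (ℓ ab) (ℓ ab + ℓ bc) (ℓ ad) (ℓ ab + ℓ be) (ℓ ab + ℓ bc + ℓ cf)
    where ℓ = lengthAt k

  z<2 : z < 2
  z<2 = s≤s (subst (z ≤_) z+z̄≡1 (m≤m+n z z̄))

  z̄<2 : z̄ < 2
  z̄<2 = s≤s (subst (z̄ ≤_) z+z̄≡1 (m≤n+m z̄ z))

  z̄≢z : z̄ ≢ z
  z̄≢z z̄≡z = m+m≢1 z (trans (cong (z +_) (sym z̄≡z)) z+z̄≡1)

  0<s : 0 < s
  0<s = >-nonZero⁻¹ s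

  odd+odd : ∀ i j → odd i + odd j ≡ even (z + (i + j))
  odd+odd i j = begin
    odd i + odd j                ≡⟨ odd+odd≡ o i j ⟩
    (o * 2 + 1 + (i + j)) * 2    ≡⟨ cong (λ x → (x + (i + j)) * 2) e+z≡2o+1 ⟨
    (e + z + (i + j)) * 2        ≡⟨ cong (_* 2) (+-assoc e z (i + j)) ⟩
    even (z + (i + j))           ∎
    where
    open ≡-Reasoning
    odd+odd≡ : ∀ o i j → (o + i) * 2 + 1 + ((o + j) * 2 + 1) ≡ (o * 2 + 1 + (i + j)) * 2
    odd+odd≡ = solve-∀

  even-< : ∀ {i j} → i < j → even i < even j
  even-< i<j = *-monoˡ-< 2 (+-monoʳ-< e i<j)

  odd<even : ∀ {i j} → i ≤ j → odd i < even j
  odd<even i≤j = [m*2+r]<n*2 (s≤s (s≤s z≤n)) (+-mono-<-≤ o<e i≤j)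

  ab+bc≡ca : ∀ k → lengthAt k ab + lengthAt k bc ≡ lengthAt k ca
  ab+bc≡ca k = trans (odd+odd k (s + k)) (cong even (pair-index≡ s k z))
    where
    pair-index≡ : ∀ s k z → z + (k + (s + k)) ≡ s + (k * 2 + z)
    pair-index≡ = solve-∀

  k≤k*2+r : ∀ k r → k ≤ k * 2 + r
  k≤k*2+r k r = ≤-trans (m≤m*n k 2) (m≤m+n (k * 2) r)

  0<ab : ∀ k → 0 < lengthAt k ab
  0<ab k = ≤-trans (s≤s z≤n) (m≤n+m 1 ((o + k) * 2))

  ab<ad : ∀ k → lengthAt k ab < lengthAt k ad
  ab<ad k = odd<even ≤-refl

  ad<ab+bc : ∀ k → lengthAt k ad < lengthAt k ab + lengthAt k bc
  ad<ab+bc k = subst (lengthAt k ad <_) (sym (ab+bc≡ca k))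
    (even-< (<-≤-trans (m<n+m k 0<s) (+-monoʳ-≤ s (k≤k*2+r k z))))

  bc<be : ∀ k → lengthAt k bc < lengthAt k be
  bc<be k = odd<even (+-monoʳ-≤ s (k≤k*2+r k z̄))

  be<bc+cf : ∀ k → lengthAt k be < lengthAt k bc + lengthAt k cf
  be<bc+cf k = subst (lengthAt k be <_) (sym (odd+odd (s + k) (2 * s + k))) (even-< (begin-strict
    s + (k * 2 + z̄)         <⟨ +-monoʳ-< s (+-monoʳ-< (k * 2) (<-≤-trans z̄<2 (*-monoʳ-≤ 2 0<s))) ⟩
    s + (k * 2 + 2 * s)     ≡⟨ outer-index≡ s k ⟩
    s + k + (2 * s + k)     ≤⟨ m≤n+m _ z ⟩
    z + (s + k + (2 * s + k)) ∎))
    where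
    open ≤-Reasoning
    outer-index≡ : ∀ s k → s + (k * 2 + 2 * s) ≡ s + k + (2 * s + k)
    outer-index≡ = solve-∀

  Covered : ℕ → Set
  Covered d = (∃[ j ] j < 3 * s × d ≡ odd j) ⊎ (∃[ j ] j < 3 * s × d ≡ even j)

  lengthAt-Covered : ∀ {k} p → k < s → Covered (lengthAt k p)
  lengthAt-Covered {k} ab k<s = inj₁ (k , <-≤-trans k<s (m≤m+n s (2 * s)) , refl)
  lengthAt-Covered {k} bc k<s = inj₁ (s + k , +-monoʳ-< s (<-≤-trans k<s (m≤m+n s (1 * s))) , refl)
  lengthAt-Covered {k} ca k<s = inj₂ (s + (k * 2 + z) , +-monoʳ-< s (pair-< z<2 k<s) , refl)
  lengthAt-Covered {k} ad k<s = inj₂ (k , <-≤-trans k<s (m≤m+n s (2 * s)) , refl)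
  lengthAt-Covered {k} be k<s = inj₂ (s + (k * 2 + z̄) , +-monoʳ-< s (pair-< z̄<2 k<s) , refl)
  lengthAt-Covered {k} cf k<s =
    inj₁ (2 * s + k , subst (2 * s + k <_) (+-comm (2 * s) s) (+-monoʳ-< (2 * s) k<s) , refl)

  oddSlot : ℕ → Slot
  oddSlot 0 = ab
  oddSlot 1 = bc
  oddSlot _ = cf

  pairSlot : ℕ → Slot
  pairSlot r with r ≟ z
  ... | yes _ = ca
  ... | no _ = be

  decodeOdd : ℕ → ℕ × Slot
  decodeOdd j = j % s , oddSlot (j / s)

  decodeEven : ℕ → ℕ × Slot
  decodeEven j with j <? s
  ... | yes _ = j , ad
  ... | no _ = (j ∸ s) / 2 , pairSlot ((j ∸ s) % 2)

  decodeBy : ℕ → ℕ → ℕ × Slot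
  decodeBy 0 h = decodeEven (h ∸ e)
  decodeBy (suc _) h = decodeOdd (h ∸ o)

  decode : ℕ → ℕ × Slot
  decode d = decodeBy (d % 2) (d / 2)

  lengthOf : ℕ × Slot → ℕ
  lengthOf (k , p) = lengthAt k p

  decode-odd : ∀ j → decode (odd j) ≡ decodeOdd j
  decode-odd j = trans (cong₂ decodeBy ([q*n+r]%n≡r (o + j) 1 2 1<2) ([q*n+r]/n≡q (o + j) 1 2 1<2))
                       (cong decodeOdd (m+n∸m≡n o j))
    where 1<2 = s≤s (s≤s z≤n)

  decode-even : ∀ j → decode (even j) ≡ decodeEven j
  decode-even j = trans (cong₂ decodeBy (m*n%n≡0 (e + j) 2) (m*n/n≡m (e + j) 2))
                        (cong decodeEven (m+n∸m≡n e j))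

  decodeOdd-q : ∀ q {r} → r < s → decodeOdd (q * s + r) ≡ (r , oddSlot q)
  decodeOdd-q q {r} r<s = cong₂ (λ r q → r , oddSlot q) ([q*n+r]%n≡r q r s r<s) ([q*n+r]/n≡q q r s r<s)

  decodeEven-< : ∀ {j} → j < s → decodeEven j ≡ (j , ad)
  decodeEven-< {j} j<s with j <? s
  ... | yes _ = refl
  ... | no j≮s = ⊥-elim (j≮s j<s)

  decodeEven-pair : ∀ k {r} → r < 2 → decodeEven (s + (k * 2 + r)) ≡ (k , pairSlot r)
  decodeEven-pair k {r} r<2 with s + (k * 2 + r) <? s
  ... | yes s+m<s = ⊥-elim (m+n≮m s _ s+m<s)
  ... | no _ rewrite m+n∸m≡n s (k * 2 + r) =
    cong₂ _,_ ([q*n+r]/n≡q k r 2 r<2) (cong pairSlot ([q*n+r]%n≡r k r 2 r<2))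

  pairSlot-z : pairSlot z ≡ ca
  pairSlot-z with z ≟ z
  ... | yes _ = refl
  ... | no z≢z = ⊥-elim (z≢z refl)

  pairSlot-z̄ : pairSlot z̄ ≡ be
  pairSlot-z̄ with z̄ ≟ z
  ... | yes z̄≡z = ⊥-elim (z̄≢z z̄≡z)
  ... | no _ = refl

  decode-lengthAt : ∀ {k} p → k < s → decode (lengthAt k p) ≡ (k , p)
  decode-lengthAt {k} ab k<s = trans (decode-odd k) (decodeOdd-q 0 k<s)
  decode-lengthAt {k} bc k<s = trans (decode-odd (s + k))
    (trans (cong (λ x → decodeOdd (x + k)) (sym (*-identityˡ s))) (decodeOdd-q 1 k<s))
  decode-lengthAt {k} ca k<s = trans (decode-even _) (trans (decodeEven-pair k z<2) (cong (k ,_) pairSlot-z))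
  decode-lengthAt {k} ad k<s = trans (decode-even k) (decodeEven-< k<s)
  decode-lengthAt {k} be k<s = trans (decode-even _) (trans (decodeEven-pair k z̄<2) (cong (k ,_) pairSlot-z̄))
  decode-lengthAt {k} cf k<s = trans (decode-odd (2 * s + k)) (decodeOdd-q 2 k<s)

  lengthAt-oddSlot : ∀ q r → q < 3 → lengthAt r (oddSlot q) ≡ odd (q * s + r)
  lengthAt-oddSlot 0 r _ = refl
  lengthAt-oddSlot 1 r _ = cong (λ x → odd (x + r)) (sym (*-identityˡ s))
  lengthAt-oddSlot 2 r _ = refl
  lengthAt-oddSlot (suc (suc (suc _))) r (s≤s (s≤s (s≤s ())))

  lengthAt-pairSlot : ∀ k {r} → r < 2 → lengthAt k (pairSlot r) ≡ even (s + (k * 2 + r))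
  lengthAt-pairSlot k {r} r<2 with r ≟ z
  ... | yes refl = refl
  ... | no r≢z = cong (λ x → even (s + (k * 2 + x))) (sym r≡z̄)
    where
    r≡z̄ : r ≡ z̄
    r≡z̄ = +-cancelʳ-≡ z r z̄ (trans (distinct-bits⇒sum≡1 r<2 z<2 r≢z) (trans (sym z+z̄≡1) (+-comm z z̄)))

  decodeEven-complete : ∀ {j} → j < 3 * s → proj₁ (decodeEven j) < s × lengthOf (decodeEven j) ≡ even j
  decodeEven-complete {j} j<3s with j <? s
  ... | yes j<s = j<s , refl
  ... | no j≮s = m<n*o⇒m/o<n m<s*2 , trans (lengthAt-pairSlot (m / 2) (m%n<n m 2)) (cong even (begin
    s + (m / 2 * 2 + m % 2)   ≡⟨ cong (s +_) (+-comm (m / 2 * 2) (m % 2)) ⟩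
    s + (m % 2 + m / 2 * 2)   ≡⟨ cong (s +_) (m≡m%n+[m/n]*n m 2) ⟨
    s + m                     ≡⟨ m+[n∸m]≡n (≮⇒≥ j≮s) ⟩
    j                         ∎))
    where
    open ≡-Reasoning
    m = j ∸ s
    m<s*2 : m < s * 2
    m<s*2 = subst (m <_) (trans (m+n∸m≡n s (2 * s)) (*-comm 2 s)) (∸-monoˡ-< j<3s (≮⇒≥ j≮s))

  decode-complete : ∀ {d} → Covered d → proj₁ (decode d) < s × lengthOf (decode d) ≡ d
  decode-complete (inj₁ (j , j<3s , refl)) rewrite decode-odd j =
    m%n<n j s , trans (lengthAt-oddSlot (j / s) (j % s) (m<n*o⇒m/o<n j<3s))
                      (cong odd (trans (+-comm (j / s * s) (j % s)) (sym (m≡m%n+[m/n]*n j s))))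
  decode-complete (inj₂ (j , j<3s , refl)) rewrite decode-even j = decodeEven-complete j<3s

  -- outer-bound says that the largest vertex 6(o + s + k) + 3 of B_k, k < s, is below u.
  module _ (u : ℕ) .{{_ : NonZero u}} (L : ℕ → Set)
           (Covered⇒L : ∀ {d} → Covered d → L d) (L⇒Covered : ∀ {d} → L d → Covered d)
           (short : ∀ {d} → L d → d + d < u) (outer-bound : o * 6 + s * 12 < u + 3) where
    open Circle u using (edgeLength; dist-comm; dist-+-half)

    lengthAt-short : ∀ {k} p → k < s → lengthAt k p + lengthAt k p ≤ u
    lengthAt-short p k<s = <⇒≤ (short (Covered⇒L (lengthAt-Covered p k<s)))

    outer-vertex-< : ∀ {k} → k < s → lengthAt k ab + lengthAt k bc + lengthAt k cf < u
    outer-vertex-< {k} k<s = +-cancelʳ-< 3 _ u (begin-strict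
      lengthAt k ab + lengthAt k bc + lengthAt k cf + 3   ≡⟨ outer-vertex≡ o s k ⟩
      o * 6 + s * 6 + suc k * 6                           ≤⟨ +-monoʳ-≤ (o * 6 + s * 6) (*-monoˡ-≤ 6 k<s) ⟩
      o * 6 + s * 6 + s * 6                               ≡⟨ +-assoc (o * 6) (s * 6) (s * 6) ⟩
      o * 6 + (s * 6 + s * 6)                             ≡⟨ cong (o * 6 +_) (*-distribˡ-+ s 6 6) ⟨
      o * 6 + s * 12                                      <⟨ outer-bound ⟩
      u + 3                                               ∎)
      where
      open ≤-Reasoning
      outer-vertex≡ : ∀ o s k → (o + k) * 2 + 1 + ((o + (s + k)) * 2 + 1) + ((o + (2 * s + k)) * 2 + 1) + 3
                                ≡ o * 6 + s * 6 + suc k * 6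
      outer-vertex≡ = solve-∀

    block-vertices : ∀ {k} → k < s → Unique (sunVertices (block k)) × All (_< u) (sunVertices (block k))
    block-vertices {k} k<s = sunVertices-distinct a<b b<d d<c c<e e<f , sunVertices-< a<b b<d d<c c<e e<f f<u
      where
      a<b = 0<ab k
      b<d = ab<ad k
      d<c = ad<ab+bc k
      c<e = +-monoʳ-< (lengthAt k ab) (bc<be k)
      e<f = subst (lengthAt k ab + lengthAt k be <_) (sym (+-assoc (lengthAt k ab) _ _))
                  (+-monoʳ-< (lengthAt k ab) (be<bc+cf k))
      f<u = outer-vertex-< k<s

    edgeLength-block : ∀ {k} p → k < s → edgeLength (sunEdge (block k) p) ≡ lengthAt k p
    edgeLength-block {k} ab k<s = dist-+-half 0 (lengthAt-short ab k<s)
    edgeLength-block {k} bc k<s = dist-+-half (lengthAt k ab) (lengthAt-short bc k<s)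
    edgeLength-block {k} ca k<s = begin
      dist u (lengthAt k ab + lengthAt k bc) 0    ≡⟨ dist-comm _ 0 ⟩
      dist u 0 (lengthAt k ab + lengthAt k bc)    ≡⟨ cong (dist u 0) (ab+bc≡ca k) ⟩
      dist u 0 (lengthAt k ca)                    ≡⟨ dist-+-half 0 (lengthAt-short ca k<s) ⟩
      lengthAt k ca                               ∎
      where open ≡-Reasoning
    edgeLength-block {k} ad k<s = dist-+-half 0 (lengthAt-short ad k<s)
    edgeLength-block {k} be k<s = dist-+-half (lengthAt k ab) (lengthAt-short be k<s)
    edgeLength-block {k} cf k<s = dist-+-half (lengthAt k ab + lengthAt k bc) (lengthAt-short cf k<s)

    baseSuns : BaseSuns u L
    baseSuns = record
      { size = s
      ; block = block
      ; slotOf = decode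
      ; vertices-distinct = proj₁ ∘ block-vertices
      ; vertices-< = proj₂ ∘ block-vertices
      ; length∈L = λ p k<s → subst L (sym (edgeLength-block p k<s)) (Covered⇒L (lengthAt-Covered p k<s))
      ; slotOf-length = λ p k<s → trans (cong decode (edgeLength-block p k<s)) (decode-lengthAt p k<s)
      ; slotOf-complete = λ {d} Ld → let (k<s , length≡d) = decode-complete (L⇒Covered Ld) in
          k<s , trans (edgeLength-block (proj₂ (decode d)) k<s) length≡d
      }

    sunDecomposition : HasSunDecomposition u L
    sunDecomposition = Development.sunDecomposition short baseSuns

parity : ∀ d → (∃[ q ] d ≡ q * 2) ⊎ (∃[ q ] d ≡ q * 2 + 1)
parity zero = inj₁ (0 , refl)
parity (suc d) with parity d
... | inj₁ (q , refl) = inj₂ (q , +-comm 1 (q * 2))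
... | inj₂ (q , refl) = inj₁ (suc q , cong suc (+-comm (q * 2) 1))

odd≢even : ∀ m n → m * 2 + 1 ≢ n * 2
odd≢even m n eq =
  1≢0 (trans (sym ([q*n+r]%n≡r m 1 2 (s≤s (s≤s z≤n)))) (trans (cong (_% 2) eq) (m*n%n≡0 n 2)))
  where
  1≢0 : 1 ≢ 0
  1≢0 ()

[m*2+1]≤n*2⇒m<n : ∀ {m n} → m * 2 + 1 ≤ n * 2 → m < n
[m*2+1]≤n*2⇒m<n {m} {n} le = *-cancelʳ-< 2 m n (<-≤-trans (m<m+n (m * 2) (s≤s z≤n)) le)

double≡ : ∀ s c → 6 * s + c + (6 * s + c) ≡ 12 * s + c * 2
double≡ = solve-∀

d≤6s+c⇒d+d<u : ∀ s c {d u} → 12 * s + c * 2 < u → d ≤ 6 * s + c → d + d < u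
d≤6s+c⇒d+d<u s c {d} bound d≤ = ≤-<-trans (subst (d + d ≤_) (double≡ s c) (+-mono-≤ d≤ d≤)) bound

6s≡3s*2 : ∀ s → 6 * s ≡ 3 * s * 2
6s≡3s*2 = solve-∀

6s+2≡[1+3s]*2 : ∀ s → 6 * s + 2 ≡ suc (3 * s) * 2
6s+2≡[1+3s]*2 = solve-∀

6s+3≡[1+3s]*2+1 : ∀ s → 6 * s + 3 ≡ suc (3 * s) * 2 + 1
6s+3≡[1+3s]*2+1 = solve-∀

6s+4≡[2+3s]*2 : ∀ s → 6 * s + 4 ≡ (2 + 3 * s) * 2
6s+4≡[2+3s]*2 = solve-∀

s*12≡12s : ∀ s → s * 12 ≡ 12 * s
s*12≡12s s = *-comm s 12

module Case0 (s : ℕ) .{{_ : NonZero s}} where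
  open SunFamily s 0 1 0 1 refl refl (s≤s z≤n)

  L⇒Covered : ∀ {d} → Lset 0 s d → Covered d
  L⇒Covered {d} (1≤d , d≤6s) with parity d
  L⇒Covered (() , _) | inj₁ (zero , refl)
  ... | inj₁ (suc j , refl) = inj₂ (j , *-cancelʳ-≤ (suc j) (3 * s) 2 (subst (d ≤_) (6s≡3s*2 s) d≤6s) , refl)
  ... | inj₂ (j , refl) = inj₁ (j , [m*2+1]≤n*2⇒m<n (subst (d ≤_) (6s≡3s*2 s) d≤6s) , refl)

  Covered⇒L : ∀ {d} → Covered d → Lset 0 s d
  Covered⇒L (inj₁ (j , j<3s , refl)) =
    m≤n+m 1 (j * 2) , subst (j * 2 + 1 ≤_) (sym (6s≡3s*2 s)) (<⇒≤ ([m*2+r]<n*2 (s≤s (s≤s z≤n)) j<3s))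
  Covered⇒L (inj₂ (j , j<3s , refl)) = s≤s z≤n , subst (suc j * 2 ≤_) (sym (6s≡3s*2 s)) (*-monoˡ-≤ 2 j<3s)

  decomposition : ∀ u .{{_ : NonZero u}} → 12 * s + 0 < u → HasSunDecomposition u (Lset 0 s)
  decomposition u bound = sunDecomposition u (Lset 0 s) Covered⇒L L⇒Covered
    (λ {d} Ld → d≤6s+c⇒d+d<u s 0 bound (subst (d ≤_) (sym (+-identityʳ (6 * s))) (proj₂ Ld)))
    (<-≤-trans (subst (_< u) (trans (+-identityʳ (12 * s)) (sym (s*12≡12s s))) bound) (m≤m+n u 3))

12s+4<u⇒6+s*12<u+3 : ∀ s {u} → 12 * s + 4 < u → 6 + s * 12 < u + 3
12s+4<u⇒6+s*12<u+3 s {u} bound =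
  subst (_< u + 3) (sym (6+s*12≡ s)) (<-≤-trans (+-monoˡ-< 2 bound) (+-monoʳ-≤ u (s≤s (s≤s z≤n))))
  where
  6+s*12≡ : ∀ s → 6 + s * 12 ≡ 12 * s + 4 + 2
  6+s*12≡ = solve-∀

module Case4 (s : ℕ) .{{_ : NonZero s}} where
  open SunFamily s 1 2 1 0 refl refl (s≤s (s≤s z≤n))

  L⇒Covered : ∀ {d} → Lset 4 s d → Covered d
  L⇒Covered {d} (3≤d , d≤) with parity d
  L⇒Covered (() , _) | inj₁ (0 , refl)
  L⇒Covered (s≤s (s≤s ()) , _) | inj₁ (1 , refl)
  ... | inj₁ (suc (suc j) , refl) =
    inj₂ (j , s≤s⁻¹ (*-cancelʳ-≤ (2 + j) (suc (3 * s)) 2 (subst (d ≤_) (6s+2≡[1+3s]*2 s) d≤)) , refl)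
  L⇒Covered (s≤s () , _) | inj₂ (0 , refl)
  ... | inj₂ (suc j , refl) = inj₁ (j , s≤s⁻¹ ([m*2+1]≤n*2⇒m<n (subst (d ≤_) (6s+2≡[1+3s]*2 s) d≤)) , refl)

  Covered⇒L : ∀ {d} → Covered d → Lset 4 s d
  Covered⇒L (inj₁ (j , j<3s , refl)) = s≤s (s≤s (m≤n+m 1 (j * 2))) ,
    subst (suc j * 2 + 1 ≤_) (sym (6s+2≡[1+3s]*2 s)) (<⇒≤ ([m*2+r]<n*2 (s≤s (s≤s z≤n)) (s≤s j<3s)))
  Covered⇒L (inj₂ (j , j<3s , refl)) = s≤s (s≤s (s≤s z≤n)) ,
    subst (suc (suc j) * 2 ≤_) (sym (6s+2≡[1+3s]*2 s)) (*-monoˡ-≤ 2 (s≤s j<3s))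

  decomposition : ∀ u .{{_ : NonZero u}} → 12 * s + 4 < u → HasSunDecomposition u (Lset 4 s)
  decomposition u bound = sunDecomposition u (Lset 4 s) Covered⇒L L⇒Covered
    (λ Ld → d≤6s+c⇒d+d<u s 2 bound (proj₂ Ld)) (12s+4<u⇒6+s*12<u+3 s bound)

module Case8 (s : ℕ) .{{_ : NonZero s}} where
  open SunFamily s 1 3 0 1 refl refl (s≤s (s≤s z≤n))

  L⇒Covered : ∀ {d} → Lset 8 s d → Covered d
  L⇒Covered {d} (3≤d , d≤ , d≢4 , d≢6s+3) with parity d
  L⇒Covered (() , _) | inj₁ (0 , refl)
  L⇒Covered (s≤s (s≤s ()) , _) | inj₁ (1 , refl)
  ... | inj₁ (2 , refl) = ⊥-elim (d≢4 refl)
  ... | inj₁ (suc (suc (suc j)) , refl) =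
    inj₂ (j , s≤s⁻¹ (s≤s⁻¹ (*-cancelʳ-≤ (3 + j) (2 + 3 * s) 2 (subst (d ≤_) (6s+4≡[2+3s]*2 s) d≤))) , refl)
  L⇒Covered (s≤s () , _) | inj₂ (0 , refl)
  ... | inj₂ (suc j , refl) = inj₁ (j , ≤∧≢⇒< j≤3s j≢3s , refl)
    where
    j≤3s : j ≤ 3 * s
    j≤3s = s≤s⁻¹ (s≤s⁻¹ ([m*2+1]≤n*2⇒m<n (subst (d ≤_) (6s+4≡[2+3s]*2 s) d≤)))
    j≢3s : j ≢ 3 * s
    j≢3s refl = d≢6s+3 (sym (6s+3≡[1+3s]*2+1 s))

  Covered⇒L : ∀ {d} → Covered d → Lset 8 s d
  Covered⇒L (inj₁ (j , j<3s , refl)) = s≤s (s≤s (m≤n+m 1 (j * 2))) ,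
    subst (suc j * 2 + 1 ≤_) (sym (6s+4≡[2+3s]*2 s))
          (<⇒≤ ([m*2+r]<n*2 (s≤s (s≤s z≤n)) (s≤s (m≤n⇒m≤1+n j<3s)))) ,
    odd≢even (suc j) 2 ,
    λ d≡6s+3 → <⇒≢ j<3s (suc-injective (*-cancelʳ-≡ (suc j) (suc (3 * s)) 2
                 (+-cancelʳ-≡ 1 _ _ (trans d≡6s+3 (6s+3≡[1+3s]*2+1 s)))))
  Covered⇒L (inj₂ (j , j<3s , refl)) = s≤s (s≤s (s≤s z≤n)) ,
    subst (suc (suc (suc j)) * 2 ≤_) (sym (6s+4≡[2+3s]*2 s)) (*-monoˡ-≤ 2 (s≤s (s≤s j<3s))) ,
    (λ ()) ,
    λ d≡6s+3 → odd≢even (suc (3 * s)) (3 + j) (sym (trans d≡6s+3 (6s+3≡[1+3s]*2+1 s)))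

  decomposition : ∀ u .{{_ : NonZero u}} → 12 * s + 8 < u → HasSunDecomposition u (Lset 8 s)
  decomposition u bound = sunDecomposition u (Lset 8 s) Covered⇒L L⇒Covered
    (λ Ld → d≤6s+c⇒d+d<u s 4 bound (proj₁ (proj₂ Ld)))
    (12s+4<u⇒6+s*12<u+3 s (<-trans (+-monoʳ-< (12 * s) (s≤s (s≤s (s≤s (s≤s (s≤s z≤n)))))) bound))

lemma2p15 : (α u s : ℕ) → (α ≡ 0 ⊎ α ≡ 4 ⊎ α ≡ 8) → 0 < u → 0 < s →
            12 * s + α < u → HasSunDecomposition u (Lset α s)
lemma2p15 .0 u s (inj₁ refl) 0<u 0<s = Case0.decomposition s {{>-nonZero 0<s}} u {{>-nonZero 0<u}}
lemma2p15 .4 u s (inj₂ (inj₁ refl)) 0<u 0<s = Case4.decomposition s {{>-nonZero 0<s}} u {{>-nonZero 0<u}}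
lemma2p15 .8 u s (inj₂ (inj₂ refl)) 0<u 0<s = Case8.decomposition s {{>-nonZero 0<s}} u {{>-nonZero 0<u}}
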